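{- Let $n,k,l$ be integers with $n\ge 2$, $k\ge n-1$ and $l\ge 0$. Suppose $[-k,\,k+2l+1]^*$ splits the cyclic group $G=\mathbb{Z}_{n(2k+2l+1)+1}$, and let $s$ and $s'$ be elements of a splitter set. Then one of the following holds: (a) there are integers $x,y$ with $1\le x\le 2n+2l-2$ and $1\le|y|\le k$ such that $xs+ys'=0$; (b) $s'=\pm(2n+2l-1)s$, $s$ generates $G$, and $k=n-1$.
   Context: For integers $a\le b$, $[a,b]^*=\{a,\dots,b\}\setminus\{0\}$. A set of integers $M$ splits an additive finite abelian group $G$ with splitter set $S\subseteq G$ if every nonzero $g\in G$ has a unique representation $g=ms$ with $m\in M$, $s\in S$, while $0$ has no such representation; here $ms$ is the $m$-fold sum of $s$ for $m\ge0$ and $-((-m)s)$ for $m<0$. -}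

module Defs where

open import Data.Nat as ℕ using (ℕ)
open import Data.Integer as ℤ using (ℤ; +_; _*_; _+_; _-_; -_; _≤_)
open import Data.Integer.Divisibility using (_∣_)
open import Data.Fin using (Fin; toℕ)
open import Data.Product using (Σ; _×_; _,_)
open import Relation.Binary.PropositionalEquality using (_≡_; _≢_)
open import Relation.Nullary using (¬_)

-- The cyclic group ℤ_N is represented by Fin N (canonical residues 0..N-1);
-- an element g : Fin N is interpreted as the integer toℕ g.
⟦_⟧ : {N : ℕ} → Fin N → ℤ
⟦ g ⟧ = + toℕ g

infix 4 _≡_[mod_]
_≡_[mod_] : ℤ → ℤ → ℕ → Set
a ≡ b [mod N ] = + N ∣ (a - b)

[_,_]* : ℤ → ℤ → ℤ → Set
[ a , b ]* m = (a ≤ m) × (m ≤ b) × (m ≢ + 0)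

Splits : (M : ℤ → Set) (N : ℕ) (S : Fin N → Set) → Set
Splits M N S =
  ((g : Fin N) → toℕ g ≢ 0 →
    Σ ℤ λ m → Σ (Fin N) λ s → M m × S s × ((m * ⟦ s ⟧) ≡ ⟦ g ⟧ [mod N ]) ×
      ((m' : ℤ) (s' : Fin N) → M m' → S s' → ((m' * ⟦ s' ⟧) ≡ ⟦ g ⟧ [mod N ]) →
        (m' ≡ m) × (s' ≡ s)))
  × ((m : ℤ) (s : Fin N) → M m → S s → ¬ (m * ⟦ s ⟧ ≡ + 0 [mod N ]))

Generates : (N : ℕ) → Fin N → Set
Generates N s = (g : Fin N) → Σ ℤ λ m → m * ⟦ s ⟧ ≡ ⟦ g ⟧ [mod N ]

{-# OPTIONS --safe #-}
-- With L = k + 2l + 1, X = 2n + 2l − 2 and c = n − 2, the box [0, X] × [0, k] together with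
-- the segment [c, k] × {k + 1} contains N + 1 + 2l(k + 1 − n) lattice points, so two of them
-- have the same value x s + y s' in ℤ_N; their difference (a, b), oriented so that b ≥ 0, is a
-- relation a s + b s' = 0.  If b = 0, then a s = 0 with 1 ≤ |a| ≤ k + L, contradicting the
-- uniqueness of the splitting (for |a| > L via L s = −(|a| − L) s); if a = 0, then b s' = 0
-- with b ∈ [−k, L]*.  Otherwise the relation is short as in (a) when both points lie in the
-- box, while a difference with a segment point has −a, b ∈ [−k, L]*, so that b s' = (−a) s
-- are two representations of one element unless s = s' (then x = 1, y = −1 works).  So
-- alternative (a) always holds.
module Submission where

open import Defs
open import Data.Nat as ℕ using (ℕ; suc; zero; _∸_; _<_; z≤n; s≤s)
import Data.Nat.Properties as ℕP
open import Data.Nat.Tactic.RingSolver as ℕSolver using ()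
open import Data.Integer as ℤ using (ℤ; +_; _*_; _+_; _-_; -_; ∣_∣; _⊖_)
import Data.Integer.Properties as ℤP
import Data.Integer.Divisibility as Unsigned
open import Data.Integer.Divisibility.Signed using (_∣_; divides; ∣⇒∣ᵤ; ∣m⇒∣-m; ∣m∣n⇒∣m-n)
open import Data.Integer.DivMod using (_%ℕ_; _/ℕ_; n%ℕd<d; a≡a%ℕn+[a/ℕn]*n)
open import Data.Integer.Tactic.RingSolver using (solve-∀)
open import Data.Fin as Fin using (Fin; toℕ; fromℕ<; splitAt; join; remQuot; combine)
import Data.Fin.Properties as FinP
open import Data.Product using (Σ; _×_; _,_; proj₁; proj₂; uncurry)
open import Data.Sum using (_⊎_; inj₁; inj₂)
open import Data.Empty using (⊥-elim)
open import Function using (_∘_)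
open import Relation.Nullary using (¬_; yes; no)
open import Relation.Binary using (tri<; tri≈; tri>)
open import Relation.Binary.PropositionalEquality

∣⇒≡0-mod : ∀ {N z} → + N ∣ z → z ≡ + 0 [mod N ]
∣⇒≡0-mod {N} {z} p = subst (+ N Unsigned.∣_) (sym (ℤP.+-identityʳ z)) (∣⇒∣ᵤ p)

residue : (N : ℕ) .{{_ : ℕ.NonZero N}} → ℤ → Fin N
residue N z = fromℕ< (n%ℕd<d z N)

∣-residue : ∀ N .{{_ : ℕ.NonZero N}} z → + N ∣ z - ⟦ residue N z ⟧
∣-residue N z = divides (z /ℕ N) (begin
  z - ⟦ residue N z ⟧              ≡⟨ cong (λ r → z - + r) (FinP.toℕ-fromℕ< (n%ℕd<d z N)) ⟩
  z - + (z %ℕ N)                   ≡⟨ cong (_- + (z %ℕ N)) (a≡a%ℕn+[a/ℕn]*n z N) ⟩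
  + (z %ℕ N) + z /ℕ N * + N - + (z %ℕ N) ≡⟨ cancel (+ (z %ℕ N)) (z /ℕ N * + N) ⟩
  z /ℕ N * + N                     ∎)
  where
  open ≡-Reasoning
  cancel : ∀ r q → r + q - r ≡ q
  cancel = solve-∀

residue-injective-mod : ∀ N .{{_ : ℕ.NonZero N}} a b → residue N a ≡ residue N b → + N ∣ a - b
residue-injective-mod N a b eq = subst (+ N ∣_) (cancel a b ⟦ residue N b ⟧)
  (∣m∣n⇒∣m-n (subst (λ r → + N ∣ a - ⟦ r ⟧) eq (∣-residue N a)) (∣-residue N b))
  where
  cancel : ∀ a b r → (a - r) - (b - r) ≡ a - b
  cancel = solve-∀

module SplitterSet {M : ℤ → Set} {N : ℕ} .{{_ : ℕ.NonZero N}} {S : Fin N → Set}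
                   (split : Splits M N S) where

  splitter-nonzero : ∀ {m t} → M m → S t → ¬ (+ N ∣ m * ⟦ t ⟧)
  splitter-nonzero Mm St N∣mt = proj₂ split _ _ Mm St (∣⇒≡0-mod N∣mt)

  splitter-unique : ∀ {m₁ m₂ t₁ t₂} → M m₁ → M m₂ → S t₁ → S t₂ →
                    + N ∣ m₁ * ⟦ t₁ ⟧ - m₂ * ⟦ t₂ ⟧ → m₁ ≡ m₂ × t₁ ≡ t₂
  splitter-unique {m₁} {m₂} {t₁} {t₂} M₁ M₂ S₁ S₂ N∣diff =
    trans (proj₁ same₁) (sym (proj₁ same₂)) , trans (proj₂ same₁) (sym (proj₂ same₂))
    where
    g : Fin N
    g = residue N (m₁ * ⟦ t₁ ⟧)
    g≢0 : toℕ g ≢ 0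
    g≢0 g≡0 = splitter-nonzero M₁ S₁ (subst (+ N ∣_) (ℤP.+-identityʳ (m₁ * ⟦ t₁ ⟧))
      (subst (λ r → + N ∣ m₁ * ⟦ t₁ ⟧ - + r) g≡0 (∣-residue N (m₁ * ⟦ t₁ ⟧))))
    shift : ∀ a b r → (a - r) - (a - b) ≡ b - r
    shift = solve-∀
    unique-rep = proj₂ (proj₂ (proj₂ (proj₂ (proj₂ (proj₁ split g g≢0)))))
    same₁ = unique-rep m₁ t₁ M₁ S₁ (∣⇒∣ᵤ (∣-residue N (m₁ * ⟦ t₁ ⟧)))
    same₂ = unique-rep m₂ t₂ M₂ S₂ (∣⇒∣ᵤ (subst (+ N ∣_) (shift (m₁ * ⟦ t₁ ⟧) (m₂ * ⟦ t₂ ⟧) ⟦ g ⟧)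
              (∣m∣n⇒∣m-n (∣-residue N (m₁ * ⟦ t₁ ⟧)) N∣diff)))

  distinct-splitters-independent : ∀ {a b t₁ t₂} → t₁ ≢ t₂ → M a → M b → S t₁ → S t₂ →
                                   ¬ (+ N ∣ a * ⟦ t₁ ⟧ - b * ⟦ t₂ ⟧)
  distinct-splitters-independent t₁≢t₂ Ma Mb S₁ S₂ = t₁≢t₂ ∘ proj₂ ∘ splitter-unique Ma Mb S₁ S₂

pos∈[-k,L]* : ∀ {k L d} → 1 ℕ.≤ d → d ℕ.≤ L → [ - + k , + L ]* (+ d)
pos∈[-k,L]* {d = suc _} _ d≤L = ℤP.neg-≤-pos , ℤ.+≤+ d≤L , λ ()

neg∈[-k,L]* : ∀ {k L d} → 1 ℕ.≤ d → d ℕ.≤ k → [ - + k , + L ]* (- + d)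
neg∈[-k,L]* {d = suc _} _ d≤k = ℤP.neg-mono-≤ (ℤ.+≤+ d≤k) , ℤ.-≤+ , λ ()

pos≢neg : ∀ {a b} → 1 ℕ.≤ a → + a ≢ - + b
pos≢neg {suc _} {zero} _ ()
pos≢neg {suc _} {suc _} _ ()

module IntervalSplitterSet {k L N : ℕ} .{{_ : ℕ.NonZero N}} {S : Fin N → Set}
                           (split : Splits [ - + k , + L ]* N S) where
  open SplitterSet split

  splitter-multiple-nonzero : 1 ℕ.≤ L → ∀ {t d} → S t → 1 ℕ.≤ d → d ℕ.≤ k ℕ.+ L → ¬ (+ N ∣ + d * ⟦ t ⟧)
  splitter-multiple-nonzero 1≤L {t} {d} St 1≤d d≤k+L N∣dt with d ℕP.≤? L
  ... | yes d≤L = splitter-nonzero (pos∈[-k,L]* 1≤d d≤L) St N∣dt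
  ... | no d≰L = pos≢neg 1≤L (proj₁ (splitter-unique (pos∈[-k,L]* 1≤L ℕP.≤-refl) (neg∈[-k,L]* 1≤j j≤k)
                   St St (subst (+ N ∣_) d·t≡L·t-[-j]·t N∣dt)))
    where
    L<d = ℕP.≰⇒> d≰L
    j = d ∸ L
    1≤j : 1 ℕ.≤ j
    1≤j = ℕP.m<n⇒0<n∸m L<d
    j≤k : j ℕ.≤ k
    j≤k = ℕP.m≤n+o⇒m∸n≤o d L (subst (d ℕ.≤_) (ℕP.+-comm k L) d≤k+L)
    split-product : ∀ a b c → (a + b) * c ≡ a * c - (- b) * c
    split-product = solve-∀
    d·t≡L·t-[-j]·t : + d * ⟦ t ⟧ ≡ + L * ⟦ t ⟧ - (- + j) * ⟦ t ⟧
    d·t≡L·t-[-j]·t = trans (cong (λ e → + e * ⟦ t ⟧) (sym (ℕP.m+[n∸m]≡n (ℕP.<⇒≤ L<d))))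
                           (split-product (+ L) (+ j) ⟦ t ⟧)

ShortRelation : (N k X : ℕ) → Fin N → Fin N → Set
ShortRelation N k X s s' = Σ ℤ λ x → Σ ℤ λ y →
  (+ 1 ℤ.≤ x) × (x ℤ.≤ + X) × (1 ℕ.≤ ∣ y ∣) × (∣ y ∣ ℕ.≤ k) ×
  (x * ⟦ s ⟧ + y * ⟦ s' ⟧ ≡ + 0 [mod N ])

short-relation-refl : ∀ {N k X} (s : Fin N) → 1 ℕ.≤ X → 1 ℕ.≤ k → ShortRelation N k X s s
short-relation-refl {N} s 1≤X 1≤k =
  + 1 , - + 1 , ℤ.+≤+ ℕP.≤-refl , ℤ.+≤+ 1≤X , ℕP.≤-refl , 1≤k ,
  ∣⇒≡0-mod (subst (+ N ∣_) (sym (cancel ⟦ s ⟧)) (divides (+ 0) refl))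
  where
  cancel : ∀ a → + 1 * a + - + 1 * a ≡ + 0
  cancel = solve-∀

module TwoSplitters {N k L X c : ℕ} .{{_ : ℕ.NonZero N}} {S : Fin N → Set}
                    (split : Splits [ - + k , + L ]* N S)
                    {s s' : Fin N} (Ss : S s) (Ss' : S s') (s≢s' : s ≢ s')
                    (k<L : k < L) (X≤c+L : X ℕ.≤ c ℕ.+ L) (c≤k : c ℕ.≤ k) where
  open SplitterSet split
  open IntervalSplitterSet split

  Relation : ℤ → ℤ → Set
  Relation a b = + N ∣ a * ⟦ s ⟧ + b * ⟦ s' ⟧

  Relation-neg : ∀ {a b} → Relation a b → Relation (- a) (- b)
  Relation-neg {a} {b} = subst (+ N ∣_) (negate a b ⟦ s ⟧ ⟦ s' ⟧) ∘ ∣m⇒∣-m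
    where
    negate : ∀ a b u v → - (a * u + b * v) ≡ (- a) * u + (- b) * v
    negate = solve-∀

  no-relation : ∀ {a b} → [ - + k , + L ]* (- a) → [ - + k , + L ]* b → ¬ Relation a b
  no-relation {a} {b} M-a Mb = distinct-splitters-independent (s≢s' ∘ sym) Mb M-a Ss' Ss
                               ∘ subst (+ N ∣_) (regroup a b ⟦ s ⟧ ⟦ s' ⟧)
    where
    regroup : ∀ a b u v → a * u + b * v ≡ b * v - (- a) * u
    regroup = solve-∀

  no-vertical-relation : ∀ {dy} → 1 ℕ.≤ dy → dy ℕ.≤ suc k → ¬ Relation (+ 0) (+ dy)
  no-vertical-relation {dy} 1≤dy dy≤1+k =
    splitter-nonzero (pos∈[-k,L]* 1≤dy (ℕP.≤-trans dy≤1+k k<L)) Ss' ∘ subst (+ N ∣_) (drop (+ dy) ⟦ s ⟧ ⟦ s' ⟧)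
    where
    drop : ∀ b u v → + 0 * u + b * v ≡ b * v
    drop = solve-∀

  no-horizontal-relation : ∀ {dx} → 1 ℕ.≤ dx → dx ℕ.≤ k ℕ.+ L → ¬ Relation (+ dx) (+ 0)
  no-horizontal-relation {dx} 1≤dx dx≤k+L =
    splitter-multiple-nonzero (ℕP.≤-trans (s≤s z≤n) k<L) Ss 1≤dx dx≤k+L ∘ subst (+ N ∣_) (drop (+ dx) ⟦ s ⟧ ⟦ s' ⟧)
    where
    drop : ∀ a u v → a * u + + 0 * v ≡ a * u
    drop = solve-∀

  short-relation : ∀ {dx y} → 1 ℕ.≤ dx → dx ℕ.≤ X → 1 ℕ.≤ ∣ y ∣ → ∣ y ∣ ℕ.≤ k →
                   Relation (+ dx) y → ShortRelation N k X s s'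
  short-relation {dx} {y} 1≤dx dx≤X 1≤∣y∣ ∣y∣≤k rel =
    + dx , y , ℤ.+≤+ 1≤dx , ℤ.+≤+ dx≤X , 1≤∣y∣ , ∣y∣≤k , ∣⇒≡0-mod rel

  value : ℕ → ℕ → ℤ
  value x y = + x * ⟦ s ⟧ + + y * ⟦ s' ⟧

  Relation-difference : ∀ x₁ y₁ x₂ y₂ → + N ∣ value x₂ y₂ - value x₁ y₁ →
                        Relation (x₂ ⊖ x₁) (y₂ ⊖ y₁)
  Relation-difference x₁ y₁ x₂ y₂ = subst (+ N ∣_) (begin
    value x₂ y₂ - value x₁ y₁
      ≡⟨ regroup (+ x₂) (+ y₂) (+ x₁) (+ y₁) ⟦ s ⟧ ⟦ s' ⟧ ⟩
    (+ x₂ - + x₁) * ⟦ s ⟧ + (+ y₂ - + y₁) * ⟦ s' ⟧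
      ≡⟨ cong₂ (λ a b → a * ⟦ s ⟧ + b * ⟦ s' ⟧) (ℤP.m-n≡m⊖n x₂ x₁) (ℤP.m-n≡m⊖n y₂ y₁) ⟩
    (x₂ ⊖ x₁) * ⟦ s ⟧ + (y₂ ⊖ y₁) * ⟦ s' ⟧ ∎)
    where
    open ≡-Reasoning
    regroup : ∀ a b c d u v → (a * u + b * v) - (c * u + d * v) ≡ (a - c) * u + (b - d) * v
    regroup = solve-∀

  Relation-swap : ∀ {x₁ y₁ x₂ y₂} → Relation (x₂ ⊖ x₁) (y₂ ⊖ y₁) → Relation (x₁ ⊖ x₂) (y₁ ⊖ y₂)
  Relation-swap {x₁} {y₁} {x₂} {y₂} rel =
    subst₂ Relation (sym (ℤP.⊖-swap x₁ x₂)) (sym (ℤP.⊖-swap y₁ y₂)) (Relation-neg {x₂ ⊖ x₁} {y₂ ⊖ y₁} rel)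

  data Region : ℕ → ℕ → Set where
    box : ∀ {x y} → x ℕ.≤ X → y ℕ.≤ k → Region x y
    top : ∀ {x} → c ℕ.≤ x → x ℕ.≤ k → Region x (suc k)

  Region-x≤k+L : ∀ {x y} → Region x y → x ℕ.≤ k ℕ.+ L
  Region-x≤k+L (box x≤X _) = ℕP.≤-trans x≤X (ℕP.≤-trans X≤c+L (ℕP.+-monoˡ-≤ L c≤k))
  Region-x≤k+L (top _ x≤k) = ℕP.≤-trans x≤k (ℕP.m≤m+n _ L)

  Region-y≤1+k : ∀ {x y} → Region x y → y ℕ.≤ suc k
  Region-y≤1+k (box _ y≤k) = ℕP.m≤n⇒m≤1+n y≤k
  Region-y≤1+k (top _ _)   = ℕP.≤-refl

  no-level-collision : ∀ {x₁ x₂ y} → Region x₂ y → x₁ < x₂ → ¬ Relation (x₂ ⊖ x₁) (y ⊖ y)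
  no-level-collision {x₁} {x₂} {y} r x₁<x₂ rel =
    no-horizontal-relation (ℕP.m<n⇒0<n∸m x₁<x₂) (ℕP.≤-trans (ℕP.m∸n≤m x₂ x₁) (Region-x≤k+L r))
      (subst₂ Relation (ℤP.⊖-≥ (ℕP.<⇒≤ x₁<x₂)) (ℤP.n⊖n≡0 y) rel)

  northeast-collision : ∀ {x₁ x₂ y₂ dy} → x₁ < x₂ → Region x₂ y₂ → 1 ℕ.≤ dy → dy ℕ.≤ y₂ →
                Relation (+ (x₂ ∸ x₁)) (+ dy) → ShortRelation N k X s s'
  northeast-collision {x₁} {x₂} {dy = dy} x₁<x₂ (box x₂≤X y₂≤k) 1≤dy dy≤y₂ =
    short-relation {x₂ ∸ x₁} {+ dy} (ℕP.m<n⇒0<n∸m x₁<x₂) (ℕP.≤-trans (ℕP.m∸n≤m x₂ x₁) x₂≤X) 1≤dy (ℕP.≤-trans dy≤y₂ y₂≤k)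
  northeast-collision {x₁} {x₂} x₁<x₂ (top _ x₂≤k) 1≤dy dy≤1+k = ⊥-elim ∘
    no-relation (neg∈[-k,L]* (ℕP.m<n⇒0<n∸m x₁<x₂) (ℕP.≤-trans (ℕP.m∸n≤m x₂ x₁) x₂≤k))
                (pos∈[-k,L]* 1≤dy (ℕP.≤-trans dy≤1+k k<L))

  northwest-collision : ∀ {x₁ x₂ y₂ dy} → x₁ ℕ.≤ X → x₂ < x₁ → Region x₂ y₂ → 1 ℕ.≤ dy → dy ℕ.≤ y₂ →
               Relation (- + (x₁ ∸ x₂)) (+ dy) → ShortRelation N k X s s'
  northwest-collision {x₁} {x₂} {dy = dy} x₁≤X x₂<x₁ (box _ y₂≤k) 1≤dy dy≤y₂ rel =
    short-relation {x₁ ∸ x₂} { - + dy} (ℕP.m<n⇒0<n∸m x₂<x₁) (ℕP.≤-trans (ℕP.m∸n≤m x₁ x₂) x₁≤X)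
      (subst (1 ℕ.≤_) (sym (ℤP.∣-i∣≡∣i∣ (+ dy))) 1≤dy)
      (subst (ℕ._≤ k) (sym (ℤP.∣-i∣≡∣i∣ (+ dy))) (ℕP.≤-trans dy≤y₂ y₂≤k))
      (subst (λ a → Relation a (- + dy)) (ℤP.neg-involutive (+ (x₁ ∸ x₂))) (Relation-neg { - + (x₁ ∸ x₂)} {+ dy} rel))
  northwest-collision {x₁} {x₂} x₁≤X x₂<x₁ (top c≤x₂ _) 1≤dy dy≤1+k = ⊥-elim ∘
    no-relation (subst [ - + k , + L ]* (sym (ℤP.neg-involutive (+ (x₁ ∸ x₂))))
                       (pos∈[-k,L]* (ℕP.m<n⇒0<n∸m x₂<x₁) dx≤L))
                (pos∈[-k,L]* 1≤dy (ℕP.≤-trans dy≤1+k k<L))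
    where
    dx≤L : x₁ ∸ x₂ ℕ.≤ L
    dx≤L = ℕP.≤-trans (ℕP.∸-monoʳ-≤ x₁ c≤x₂) (ℕP.≤-trans (ℕP.∸-monoˡ-≤ c x₁≤X) (ℕP.m≤n+o⇒m∸n≤o X c X≤c+L))

  rising-collision : ∀ {x₁ y₁ x₂ y₂} → Region x₁ y₁ → Region x₂ y₂ → y₁ < y₂ →
                     Relation (x₂ ⊖ x₁) (y₂ ⊖ y₁) → ShortRelation N k X s s'
  rising-collision (top _ _) r₂ y₁<y₂ _ = ⊥-elim (ℕP.<⇒≱ y₁<y₂ (Region-y≤1+k r₂))
  rising-collision {x₁} {y₁} {x₂} {y₂} (box x₁≤X _) r₂ y₁<y₂ rel with ℕP.<-cmp x₁ x₂
  ... | tri≈ _ refl _ = ⊥-elim (no-vertical-relation 1≤dy (ℕP.≤-trans dy≤y₂ (Region-y≤1+k r₂))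
                          (subst₂ Relation (ℤP.n⊖n≡0 x₁) y₂⊖y₁≡dy rel))
    where
    1≤dy = ℕP.m<n⇒0<n∸m y₁<y₂
    dy≤y₂ = ℕP.m∸n≤m y₂ y₁
    y₂⊖y₁≡dy = ℤP.⊖-≥ (ℕP.<⇒≤ y₁<y₂)
  ... | tri< x₁<x₂ _ _ = northeast-collision x₁<x₂ r₂ (ℕP.m<n⇒0<n∸m y₁<y₂) (ℕP.m∸n≤m y₂ y₁)
                           (subst₂ Relation (ℤP.⊖-≥ (ℕP.<⇒≤ x₁<x₂)) (ℤP.⊖-≥ (ℕP.<⇒≤ y₁<y₂)) rel)
  ... | tri> _ _ x₂<x₁ = northwest-collision x₁≤X x₂<x₁ r₂ (ℕP.m<n⇒0<n∸m y₁<y₂) (ℕP.m∸n≤m y₂ y₁)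
                           (subst₂ Relation (ℤP.⊖-< x₂<x₁) (ℤP.⊖-≥ (ℕP.<⇒≤ y₁<y₂)) rel)

  collision : ∀ {x₁ y₁ x₂ y₂} → Region x₁ y₁ → Region x₂ y₂ → (x₁ , y₁) ≢ (x₂ , y₂) →
              Relation (x₂ ⊖ x₁) (y₂ ⊖ y₁) → ShortRelation N k X s s'
  collision {x₁} {y₁} {x₂} {y₂} r₁ r₂ p₁≢p₂ rel with ℕP.<-cmp y₁ y₂
  ... | tri< y₁<y₂ _ _ = rising-collision r₁ r₂ y₁<y₂ rel
  ... | tri> _ _ y₂<y₁ = rising-collision r₂ r₁ y₂<y₁ (Relation-swap {x₁} {y₁} {x₂} {y₂} rel)
  ... | tri≈ _ refl _ with ℕP.<-cmp x₁ x₂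
  ...   | tri< x₁<x₂ _ _ = ⊥-elim (no-level-collision r₂ x₁<x₂ rel)
  ...   | tri≈ _ refl _ = ⊥-elim (p₁≢p₂ refl)
  ...   | tri> _ _ x₂<x₁ = ⊥-elim (no-level-collision r₁ x₂<x₁ (Relation-swap {x₁} {y₁} {x₂} {y₁} rel))

  enumerate : Fin (suc X ℕ.* suc k) ⊎ Fin (suc k ∸ c) → ℕ × ℕ
  enumerate (inj₁ b) = toℕ (proj₁ (remQuot {suc X} (suc k) b)) , toℕ (proj₂ (remQuot {suc X} (suc k) b))
  enumerate (inj₂ j) = c ℕ.+ toℕ j , suc k

  enumerate-in-Region : ∀ u → uncurry Region (enumerate u)
  enumerate-in-Region (inj₁ b) = box (ℕP.≤-pred (FinP.toℕ<n _)) (ℕP.≤-pred (FinP.toℕ<n _))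
  enumerate-in-Region (inj₂ j) = top (ℕP.m≤m+n c _) (ℕP.≤-pred (begin-strict
    c ℕ.+ toℕ j        <⟨ ℕP.+-monoʳ-< c (FinP.toℕ<n j) ⟩
    c ℕ.+ (suc k ∸ c)  ≡⟨ ℕP.m+[n∸m]≡n (ℕP.m≤n⇒m≤1+n c≤k) ⟩
    suc k              ∎))
    where open ℕP.≤-Reasoning

  enumerate-injective : ∀ u v → enumerate u ≡ enumerate v → u ≡ v
  enumerate-injective (inj₁ a) (inj₁ b) eq = cong inj₁ (begin
    a                                            ≡⟨ FinP.combine-remQuot {suc X} (suc k) a ⟨
    uncurry combine (remQuot {suc X} (suc k) a)  ≡⟨ cong (uncurry combine) same-digits ⟩
    uncurry combine (remQuot {suc X} (suc k) b)  ≡⟨ FinP.combine-remQuot {suc X} (suc k) b ⟩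
    b                                            ∎)
    where
    open ≡-Reasoning
    same-digits = cong₂ _,_ (FinP.toℕ-injective (cong proj₁ eq)) (FinP.toℕ-injective (cong proj₂ eq))
  enumerate-injective (inj₁ a) (inj₂ j) eq = ⊥-elim (ℕP.<-irrefl (cong proj₂ eq) (FinP.toℕ<n _))
  enumerate-injective (inj₂ i) (inj₁ b) eq = ⊥-elim (ℕP.<-irrefl (sym (cong proj₂ eq)) (FinP.toℕ<n _))
  enumerate-injective (inj₂ i) (inj₂ j) eq =
    cong inj₂ (FinP.toℕ-injective (ℕP.+-cancelˡ-≡ c _ _ (cong proj₁ eq)))

  point : Fin (suc X ℕ.* suc k ℕ.+ (suc k ∸ c)) → ℕ × ℕ
  point = enumerate ∘ splitAt (suc X ℕ.* suc k)

  point-injective : ∀ i j → point i ≡ point j → i ≡ j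
  point-injective i j eq = begin
    i                                       ≡⟨ FinP.join-splitAt (suc X ℕ.* suc k) _ i ⟨
    join (suc X ℕ.* suc k) _ (splitAt _ i)  ≡⟨ cong (join _ _) (enumerate-injective _ _ eq) ⟩
    join (suc X ℕ.* suc k) _ (splitAt _ j)  ≡⟨ FinP.join-splitAt (suc X ℕ.* suc k) _ j ⟩
    j                                       ∎
    where open ≡-Reasoning

  short-relation-exists : N < suc X ℕ.* suc k ℕ.+ (suc k ∸ c) → ShortRelation N k X s s'
  short-relation-exists N<size with FinP.pigeonhole N<size (residue N ∘ uncurry value ∘ point)
  ... | i , j , i<j , same-residue =
    collision (enumerate-in-Region (splitAt _ i)) (enumerate-in-Region (splitAt _ j))
      (FinP.<⇒≢ i<j ∘ point-injective i j)
      (Relation-difference (proj₁ (point i)) (proj₂ (point i)) (proj₁ (point j)) (proj₂ (point j))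
        (residue-injective-mod N (uncurry value (point j)) (uncurry value (point i)) (sym same-residue)))
data Admissible : ℕ → ℕ → Set where
  admissible : ∀ a t → Admissible (2 ℕ.+ a) (1 ℕ.+ a ℕ.+ t)

admissible-view : ∀ {n k} → 2 ℕ.≤ n → n ∸ 1 ℕ.≤ k → Admissible n k
admissible-view {suc (suc a)} _ n∸1≤k with ℕP.m≤n⇒∃[o]m+o≡n n∸1≤k
... | t , refl = admissible a t
admissible-view {suc zero} (s≤s ()) _

2[2+a]+2l∸2≡2a+2l+2 : ∀ a l → 2 ℕ.* (2 ℕ.+ a) ℕ.+ 2 ℕ.* l ∸ 2 ≡ 2 ℕ.* a ℕ.+ 2 ℕ.* l ℕ.+ 2
2[2+a]+2l∸2≡2a+2l+2 a l = trans (cong (_∸ 2) (regroup a l)) (ℕP.m+n∸m≡n 2 _)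
  where
  regroup : ∀ a l → 2 ℕ.* (2 ℕ.+ a) ℕ.+ 2 ℕ.* l ≡ 2 ℕ.+ (2 ℕ.* a ℕ.+ 2 ℕ.* l ℕ.+ 2)
  regroup = ℕSolver.solve-∀

2+a+t∸a≡2+t : ∀ a t → 2 ℕ.+ a ℕ.+ t ∸ a ≡ 2 ℕ.+ t
2+a+t∸a≡2+t a t = trans (cong (λ m → 2 ℕ.+ m ∸ a) (ℕP.+-comm a t)) (ℕP.m+n∸n≡m (2 ℕ.+ t) a)

k<k+2l+1 : ∀ k l → k ℕ.< k ℕ.+ 2 ℕ.* l ℕ.+ 1
k<k+2l+1 k l = ℕP.m+n≤o⇒m≤o (suc k) (ℕP.≤-reflexive (eq k l))
  where
  eq : ∀ k l → suc k ℕ.+ 2 ℕ.* l ≡ k ℕ.+ 2 ℕ.* l ℕ.+ 1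
  eq = ℕSolver.solve-∀

n∸2≤k : ∀ {n k} → Admissible n k → n ∸ 2 ℕ.≤ k
n∸2≤k (admissible a t) = ℕP.m+n≤o⇒m≤o a (ℕP.≤-reflexive (ℕP.+-suc a t))

1≤k : ∀ {n k} → Admissible n k → 1 ℕ.≤ k
1≤k (admissible a t) = s≤s z≤n

1≤2n+2l∸2 : ∀ {n k} l → Admissible n k → 1 ℕ.≤ 2 ℕ.* n ℕ.+ 2 ℕ.* l ∸ 2
1≤2n+2l∸2 l (admissible a t) rewrite 2[2+a]+2l∸2≡2a+2l+2 a l = ℕP.≤-trans (ℕP.n≤1+n 1) (ℕP.m≤n+m 2 _)

2n+2l∸2≤n∸2+k+2l+1 : ∀ {n k} l → Admissible n k → 2 ℕ.* n ℕ.+ 2 ℕ.* l ∸ 2 ℕ.≤ n ∸ 2 ℕ.+ (k ℕ.+ 2 ℕ.* l ℕ.+ 1)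
2n+2l∸2≤n∸2+k+2l+1 l (admissible a t) rewrite 2[2+a]+2l∸2≡2a+2l+2 a l = ℕP.m+n≤o⇒m≤o _ (ℕP.≤-reflexive (eq a t l))
  where
  eq : ∀ a t l → 2 ℕ.* a ℕ.+ 2 ℕ.* l ℕ.+ 2 ℕ.+ t ≡ a ℕ.+ (1 ℕ.+ a ℕ.+ t ℕ.+ 2 ℕ.* l ℕ.+ 1)
  eq = ℕSolver.solve-∀

order<region-size : ∀ {n k} l → Admissible n k →
  suc (n ℕ.* (2 ℕ.* k ℕ.+ 2 ℕ.* l ℕ.+ 1)) ℕ.< suc (2 ℕ.* n ℕ.+ 2 ℕ.* l ∸ 2) ℕ.* suc k ℕ.+ (suc k ∸ (n ∸ 2))
order<region-size l (admissible a t)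
  rewrite 2[2+a]+2l∸2≡2a+2l+2 a l | 2+a+t∸a≡2+t a t = ℕP.m+n≤o⇒m≤o _ (ℕP.≤-reflexive (eq a t l))
  where
  eq : ∀ a t l → suc (suc ((2 ℕ.+ a) ℕ.* (2 ℕ.* (1 ℕ.+ a ℕ.+ t) ℕ.+ 2 ℕ.* l ℕ.+ 1))) ℕ.+ 2 ℕ.* l ℕ.* t
               ≡ suc (2 ℕ.* a ℕ.+ 2 ℕ.* l ℕ.+ 2) ℕ.* suc (1 ℕ.+ a ℕ.+ t) ℕ.+ (2 ℕ.+ t)
  eq = ℕSolver.solve-∀

lemma4p2 : (n k l : ℕ) → 2 ℕ.≤ n → n ∸ 1 ℕ.≤ k →
    (S : Fin (suc (n ℕ.* (2 ℕ.* k ℕ.+ 2 ℕ.* l ℕ.+ 1))) → Set) →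
    Splits [ - (+ k) , + (k ℕ.+ 2 ℕ.* l ℕ.+ 1) ]* (suc (n ℕ.* (2 ℕ.* k ℕ.+ 2 ℕ.* l ℕ.+ 1))) S →
    (s s' : Fin (suc (n ℕ.* (2 ℕ.* k ℕ.+ 2 ℕ.* l ℕ.+ 1)))) → S s → S s' →
    (Σ ℤ λ x → Σ ℤ λ y →
        (+ 1 ℤ.≤ x) × (x ℤ.≤ + (2 ℕ.* n ℕ.+ 2 ℕ.* l ∸ 2)) ×
        (1 ℕ.≤ ∣ y ∣) × (∣ y ∣ ℕ.≤ k) ×
        (x * ⟦ s ⟧ + y * ⟦ s' ⟧ ≡ + 0 [mod suc (n ℕ.* (2 ℕ.* k ℕ.+ 2 ℕ.* l ℕ.+ 1)) ]))
    ⊎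
    (((⟦ s' ⟧ ≡ + (2 ℕ.* n ℕ.+ 2 ℕ.* l ∸ 1) * ⟦ s ⟧ [mod suc (n ℕ.* (2 ℕ.* k ℕ.+ 2 ℕ.* l ℕ.+ 1)) ])
       ⊎ (⟦ s' ⟧ ≡ - (+ (2 ℕ.* n ℕ.+ 2 ℕ.* l ∸ 1)) * ⟦ s ⟧ [mod suc (n ℕ.* (2 ℕ.* k ℕ.+ 2 ℕ.* l ℕ.+ 1)) ]))
     × Generates (suc (n ℕ.* (2 ℕ.* k ℕ.+ 2 ℕ.* l ℕ.+ 1))) s
     × (k ≡ n ∸ 1))
lemma4p2 n k l 2≤n n∸1≤k S split s s' Ss Ss' with s Fin.≟ s' | admissible-view 2≤n n∸1≤k
... | yes refl | nk = inj₁ (short-relation-refl s (1≤2n+2l∸2 l nk) (1≤k nk))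
... | no s≢s'  | nk = inj₁ (TwoSplitters.short-relation-exists split Ss Ss' s≢s'
                         (k<k+2l+1 k l) (2n+2l∸2≤n∸2+k+2l+1 l nk) (n∸2≤k nk) (order<region-size l nk))
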